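{- The simple degree sequence region $\mathbb D[\varphi^*_{JMS}]$ is fully graphic, where $\varphi^*_{JMS}(n,\Sigma,c_1,c_2)$ is the inequality $$(\Sigma-nc_2)(nc_1-\Sigma)\le (c_1-c_2)\big\{(\Sigma-nc_2)(n-c_1-1)+(nc_1-\Sigma)c_2\big\}.$$
   Context: For natural numbers $n>c_1\ge c_2$ and $\Sigma$, $\mathcal D(n,\Sigma,c_1,c_2)$ is the set of integer sequences $(d_1,\dots,d_n)$ with $c_1\ge d_1\ge\dots\ge d_n\ge c_2$, $\sum_i d_i$ even and $\sum_i d_i=\Sigma$. For a property $\varphi$, $\mathbb D[\varphi]$ is the union of all $\mathcal D(n,\Sigma,c_1,c_2)$ with $n>c_1\ge c_2$ and $\varphi(n,\Sigma,c_1,c_2)$ true. A region is fully graphic if every sequence in it is graphic (the degree sequence of a simple graph on labelled vertices). -}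

module Defs where

open import Data.Nat using (ℕ; zero; suc; _+_; _*_; _≤_; _<_)
open import Data.Nat.Divisibility using (_∣_)
open import Data.Integer as ℤ using (ℤ; +_)
open import Data.Fin using (Fin; zero; suc) renaming (_≤_ to _≤ᶠ_)
open import Data.Bool using (Bool; true; false; if_then_else_)
open import Data.Product using (Σ; _×_)
open import Relation.Binary.PropositionalEquality using (_≡_)

sumFin : (n : ℕ) → (Fin n → ℕ) → ℕ
sumFin zero    f = 0
sumFin (suc n) f = f zero + sumFin n (λ i → f (suc i))

record SimpleGraph (n : ℕ) : Set where
  field
    adj       : Fin n → Fin n → Bool
    symmetric : ∀ i j → adj i j ≡ adj j i
    loopless  : ∀ i → adj i i ≡ false

open SimpleGraph public

degree : {n : ℕ} → SimpleGraph n → Fin n → ℕ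
degree {n} G i = sumFin n (λ j → if adj G i j then 1 else 0)

Graphic : {n : ℕ} → (Fin n → ℕ) → Set
Graphic {n} d = Σ (SimpleGraph n) (λ G → ∀ i → degree G i ≡ d i)

InD : (n S c₁ c₂ : ℕ) → (Fin n → ℕ) → Set
InD n S c₁ c₂ d =
    (∀ i → d i ≤ c₁)
  × (∀ i → c₂ ≤ d i)
  × (∀ i j → i ≤ᶠ j → d j ≤ d i)
  × (2 ∣ sumFin n d)
  × (sumFin n d ≡ S)

φJMS : (n S c₁ c₂ : ℕ) → Set
φJMS n S c₁ c₂ =
  ((+ S ℤ.- + n ℤ.* + c₂) ℤ.* (+ n ℤ.* + c₁ ℤ.- + S))
    ℤ.≤
  (+ c₁ ℤ.- + c₂) ℤ.* ( (+ S ℤ.- + n ℤ.* + c₂) ℤ.* (+ n ℤ.- + c₁ ℤ.- + 1)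
                      ℤ.+ (+ n ℤ.* + c₁ ℤ.- + S) ℤ.* + c₂ )

InRegion : {n : ℕ} → (Fin n → ℕ) → Set
InRegion {n} d = Σ ℕ λ S → Σ ℕ λ c₁ → Σ ℕ λ c₂ →
  (c₁ < n) × (c₂ ≤ c₁) × φJMS n S c₁ c₂ × InD n S c₁ c₂ d

-- By the Erdős–Gallai theorem it suffices to show, for every k ≤ n, that the k largest degrees
-- sum to at most k(k − 1) + Σ_{j ≥ k} min(d_j, k).  For k > c₁ or k ≤ c₂ this is immediate.  For
-- c₂ < k ≤ c₁ write d_j = c₂ + u_j with 0 ≤ u_j ≤ Δ = c₁ − c₂ and k = c₂ + s: concavity of
-- min(·, s) gives s·u_j ≤ Δ·min(u_j, s) in the tail, and what is left is a quadratic inequality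
-- in the excesses of head and tail, which follows from φ*_JMS through one of four explicit
-- certificates writing Δ·G or Δ²·G as a sum of nonnegative terms.
-- The Erdős–Gallai theorem itself follows Choudum's induction on the degree sum: lowering by one
-- the last entry t of the block of maximal degrees and the last positive entry m preserves the
-- Erdős–Gallai inequalities (in the critical case because the degree sum is even), and a
-- realisation of the lowered sequence receives the edge tm, directly or after a 2-switch.

module Submission where

open import Defs
open import Data.Nat using (ℕ)
open import Data.Fin using (Fin)

module IntegerCertificates where

  open import Data.Nat using (z≤n; s≤s)
  open import Data.Integer
  open import Data.Integer.Properties
  open import Data.Integer.Tactic.RingSolver using (solve-∀)
  open import Relation.Nullary using (yes; no)
  open import Relation.Binary.PropositionalEquality

  -- φJMS n S c₁ c₂ unfolds to JMS (+ n) (+ S) (+ c₁) (+ c₂).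
  JMS : ℤ → ℤ → ℤ → ℤ → Set
  JMS n S c₁ c₂ = (S - n * c₂) * (n * c₁ - S) ≤ (c₁ - c₂) * ((S - n * c₂) * (n - c₁ - 1ℤ) + (n * c₁ - S) * c₂)

  0≤i+j : ∀ {i j} → 0ℤ ≤ i → 0ℤ ≤ j → 0ℤ ≤ i + j
  0≤i+j = +-mono-≤

  0≤i*j : ∀ {i j} → 0ℤ ≤ i → 0ℤ ≤ j → 0ℤ ≤ i * j
  0≤i*j {+ m} {+ n} _ _ = subst (0ℤ ≤_) (pos-* m n) (+≤+ z≤n)

  0≤k*i⇒0≤i : ∀ {k i} → 0ℤ < k → 0ℤ ≤ k * i → 0ℤ ≤ i
  0≤k*i⇒0≤i {+0}       (+<+ ())
  0≤k*i⇒0≤i {+[1+ m ]} {i} _ 0≤ki =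
    *-cancelˡ-≤-pos 0ℤ i +[1+ m ] (subst (_≤ +[1+ m ] * i) (sym (*-zeroʳ +[1+ m ])) 0≤ki)

  0≤-≡ : ∀ {i j} → i ≡ j → 0ℤ ≤ j → 0ℤ ≤ i
  0≤-≡ i≡j = subst (0ℤ ≤_) (sym i≡j)

  -- For c₂ < k ≤ c₁ < n: c = c₂, Δ = c₁ − c₂, k = c + s, n = c₁ + 1 + r, ℓ = Σ_{j<k} (d_j − c),
  -- p = Σ_{k≤j<n} (d_j − c) and τ = Σ_{k≤j<n} min(d_j − c, s).  G ≥ 0 is the Erdős–Gallai
  -- inequality at k, and Φ ≥ 0 is φ*_JMS.
  module JMSBound (c Δ s r ℓ p τ : ℤ) where

    n k x y W Φ G : ℤ
    n = c + Δ + 1ℤ + r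
    k = c + s
    x = ℓ + p
    y = n * Δ - x
    W = Δ * (c + Δ + 1ℤ) - x
    Φ = Δ * (x * r + y * c) - x * y
    G = k * k + ((n - k) * c + τ) - (k * c + ℓ + k)

    -- solve-∀ does not unfold the abbreviations above, so each identity restates them with let.
    jms-slack : Φ ≡ (c + Δ - c) * ((n * c + x - n * c) * (n - (c + Δ) - 1ℤ) + (n * (c + Δ) - (n * c + x)) * c)
                - (n * c + x - n * c) * (n * (c + Δ) - (n * c + x))
    jms-slack = identity c Δ s r ℓ p τ
      where
      identity : ∀ c Δ s r ℓ p τ →
        let n = c + Δ + 1ℤ + r; x = ℓ + p; y = n * Δ - x; Φ = Δ * (x * r + y * c) - x * y
        in  Φ ≡ (c + Δ - c) * ((n * c + x - n * c) * (n - (c + Δ) - 1ℤ) + (n * (c + Δ) - (n * c + x)) * c)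
                - (n * c + x - n * c) * (n * (c + Δ) - (n * c + x))
      identity = solve-∀

    -- A and B cover k·Δ ≤ x (with W ≤ 0 and W > 0), C and D cover x < k·Δ (with
    -- Δ·(2c + 1) ≤ k·Δ + x or not); in its case every summand on the right is nonnegative.
    certificate-A : Δ * G ≡ (Δ * τ - s * p) + (k * Δ - ℓ) * (Δ + s) + c * y + k * (0ℤ - W)
    certificate-A = identity c Δ s r ℓ p τ
      where
      identity : ∀ c Δ s r ℓ p τ →
        let n = c + Δ + 1ℤ + r; k = c + s; x = ℓ + p; y = n * Δ - x
            G = k * k + ((n - k) * c + τ) - (k * c + ℓ + k); W = Δ * (c + Δ + 1ℤ) - x
        in  Δ * G ≡ (Δ * τ - s * p) + (k * Δ - ℓ) * (Δ + s) + c * y + k * (0ℤ - W)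
      identity = solve-∀

    certificate-B : Δ * (Δ * G) ≡ Δ * (Δ * τ - s * p) + Δ * ((k * Δ - ℓ) * (Δ + s)) + Φ + W * (x - k * Δ)
    certificate-B = identity c Δ s r ℓ p τ
      where
      identity : ∀ c Δ s r ℓ p τ →
        let n = c + Δ + 1ℤ + r; k = c + s; x = ℓ + p; y = n * Δ - x
            G = k * k + ((n - k) * c + τ) - (k * c + ℓ + k); W = Δ * (c + Δ + 1ℤ) - x
            Φ = Δ * (x * r + y * c) - x * y
        in  Δ * (Δ * G) ≡ Δ * (Δ * τ - s * p) + Δ * ((k * Δ - ℓ) * (Δ + s)) + Φ + W * (x - k * Δ)
      identity = solve-∀

    certificate-C : Δ * (Δ * G) ≡ Δ * (Δ * τ - s * p) + Δ * ((Δ + s) * p) + Φ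
                                  + (k * Δ - x) * (k * Δ + x - Δ * (+ 2 * c + 1ℤ))
    certificate-C = identity c Δ s r ℓ p τ
      where
      identity : ∀ c Δ s r ℓ p τ →
        let n = c + Δ + 1ℤ + r; k = c + s; x = ℓ + p; y = n * Δ - x
            G = k * k + ((n - k) * c + τ) - (k * c + ℓ + k); Φ = Δ * (x * r + y * c) - x * y
        in  Δ * (Δ * G) ≡ Δ * (Δ * τ - s * p) + Δ * ((Δ + s) * p) + Φ
                          + (k * Δ - x) * (k * Δ + x - Δ * (+ 2 * c + 1ℤ))
      identity = solve-∀

    certificate-D : Δ * G ≡ (Δ * τ - s * p) + (Δ + s) * p
                            + Δ * ((Δ * (+ 2 * c + 1ℤ) - (1ℤ + (k * Δ + x))) + (s - 1ℤ) * (s + Δ) + c * r + 1ℤ)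
    certificate-D = identity c Δ s r ℓ p τ
      where
      identity : ∀ c Δ s r ℓ p τ →
        let n = c + Δ + 1ℤ + r; k = c + s; x = ℓ + p; y = n * Δ - x
            G = k * k + ((n - k) * c + τ) - (k * c + ℓ + k)
        in  Δ * G ≡ (Δ * τ - s * p) + (Δ + s) * p
                    + Δ * ((Δ * (+ 2 * c + 1ℤ) - (1ℤ + (k * Δ + x))) + (s - 1ℤ) * (s + Δ) + c * r + 1ℤ)
      identity = solve-∀

    jms-eg-bound : 0ℤ ≤ c → 0ℤ ≤ r → 1ℤ ≤ s → s ≤ Δ → 0ℤ ≤ p →
                   ℓ ≤ k * Δ → x ≤ n * Δ → s * p ≤ Δ * τ →
                   JMS n (n * c + x) (c + Δ) c → k * c + ℓ + k ≤ k * k + ((n - k) * c + τ)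
    jms-eg-bound 0≤c 0≤r 1≤s s≤Δ 0≤p ℓ≤kΔ x≤nΔ sp≤Δτ jms = 0≤i-j⇒j≤i 0≤G
      where
      0<Δ : 0ℤ < Δ
      0<Δ = <-≤-trans (+<+ (s≤s z≤n)) (≤-trans 1≤s s≤Δ)
      0≤Δ : 0ℤ ≤ Δ
      0≤Δ = <⇒≤ 0<Δ
      0≤s : 0ℤ ≤ s
      0≤s = ≤-trans (+≤+ z≤n) 1≤s
      0≤k : 0ℤ ≤ k
      0≤k = 0≤i+j 0≤c 0≤s
      0≤Δ+s : 0ℤ ≤ Δ + s
      0≤Δ+s = 0≤i+j 0≤Δ 0≤s
      0≤y : 0ℤ ≤ y
      0≤y = i≤j⇒0≤j-i x≤nΔ
      0≤Φ : 0ℤ ≤ Φ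
      0≤Φ = 0≤-≡ jms-slack (i≤j⇒0≤j-i jms)
      0≤Δτ-sp : 0ℤ ≤ Δ * τ - s * p
      0≤Δτ-sp = i≤j⇒0≤j-i sp≤Δτ
      0≤kΔ-ℓ : 0ℤ ≤ k * Δ - ℓ
      0≤kΔ-ℓ = i≤j⇒0≤j-i ℓ≤kΔ
      0≤G : 0ℤ ≤ G
      0≤G with k * Δ ≤? x | W ≤? 0ℤ | Δ * (+ 2 * c + 1ℤ) ≤? k * Δ + x
      ... | yes kΔ≤x | yes W≤0 | _ = 0≤k*i⇒0≤i 0<Δ (0≤-≡ certificate-A
            (0≤i+j (0≤i+j (0≤i+j 0≤Δτ-sp (0≤i*j 0≤kΔ-ℓ 0≤Δ+s)) (0≤i*j 0≤c 0≤y))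
                   (0≤i*j 0≤k (i≤j⇒0≤j-i W≤0))))
      ... | yes kΔ≤x | no  W≰0 | _ = 0≤k*i⇒0≤i 0<Δ (0≤k*i⇒0≤i 0<Δ (0≤-≡ certificate-B
            (0≤i+j (0≤i+j (0≤i+j (0≤i*j 0≤Δ 0≤Δτ-sp) (0≤i*j 0≤Δ (0≤i*j 0≤kΔ-ℓ 0≤Δ+s))) 0≤Φ)
                   (0≤i*j (<⇒≤ (≰⇒> W≰0)) (i≤j⇒0≤j-i kΔ≤x)))))
      ... | no  kΔ≰x | _       | yes wide = 0≤k*i⇒0≤i 0<Δ (0≤k*i⇒0≤i 0<Δ (0≤-≡ certificate-C
            (0≤i+j (0≤i+j (0≤i+j (0≤i*j 0≤Δ 0≤Δτ-sp) (0≤i*j 0≤Δ (0≤i*j 0≤Δ+s 0≤p))) 0≤Φ)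
                   (0≤i*j (i≤j⇒0≤j-i (<⇒≤ (≰⇒> kΔ≰x))) (i≤j⇒0≤j-i wide)))))
      ... | no  kΔ≰x | _       | no narrow = 0≤k*i⇒0≤i 0<Δ (0≤-≡ certificate-D
            (0≤i+j (0≤i+j 0≤Δτ-sp (0≤i*j 0≤Δ+s 0≤p))
                   (0≤i*j 0≤Δ (0≤i+j (0≤i+j (0≤i+j (i≤j⇒0≤j-i (i<j⇒suc[i]≤j (≰⇒> narrow)))
                                                   (0≤i*j (i≤j⇒0≤j-i 1≤s) (0≤i+j 0≤s 0≤Δ)))
                                            (0≤i*j 0≤c 0≤r))
                                     (+≤+ z≤n)))))

open IntegerCertificates using (JMS; module JMSBound)

open import Data.Nat
open import Data.Nat.Properties
open import Data.Nat.Divisibility using (_∣_; _∤_; divides; ∣m+n∣m⇒∣n; ∣1⇒≡1; ∣-refl)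
open import Data.Nat.Tactic.RingSolver using (solve-∀)
open import Algebra.Properties.CommutativeSemigroup +-commutativeSemigroup using (interchange; xy∙z≈xz∙y; xy∙z≈zy∙x)
open import Data.Fin as Fin using (zero; suc; toℕ; fromℕ<)
open import Data.Fin.Properties using (toℕ-injective; toℕ<n; toℕ-fromℕ<; any?)
import Data.Fin.Properties as Finₚ
open import Data.Bool as Bool using (Bool; true; false; if_then_else_; _∧_; _∨_)
open import Data.Bool.Properties using (∧-comm; ∨-comm; ∨-identityʳ)
open import Data.Product using (∃-syntax; _×_; _,_; uncurry)
open import Data.Sum using (_⊎_; inj₁; inj₂; [_,_]′)
open import Function using (_∘_)
open import Relation.Nullary using (¬_; Dec; contradiction; yes; no; does; ¬?)
open import Relation.Nullary.Decidable using (dec-true; dec-false; _×-dec_)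
open import Relation.Unary using (Decidable)
open import Relation.Binary.Definitions using (tri<; tri≈; tri>)
open import Relation.Binary.PropositionalEquality

-- Sums over initial segments and intervals of ℕ

∑ : ℕ → (ℕ → ℕ) → ℕ
∑ zero    f = 0
∑ (suc n) f = f 0 + ∑ n (f ∘ suc)

syntax ∑ n (λ j → e) = ∑[ j < n ] e

∑-between : ℕ → ℕ → (ℕ → ℕ) → ℕ
∑-between k n f = ∑ (n ∸ k) (λ j → f (k + j))

syntax ∑-between k n (λ j → e) = ∑[ k ≤ j < n ] e

∑-cong : ∀ n {f g} → (∀ {j} → j < n → f j ≡ g j) → ∑ n f ≡ ∑ n g
∑-cong zero    f≗g = refl
∑-cong (suc n) f≗g = cong₂ _+_ (f≗g z<s) (∑-cong n (f≗g ∘ s<s))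

∑-mono : ∀ n {f g} → (∀ {j} → j < n → f j ≤ g j) → ∑ n f ≤ ∑ n g
∑-mono zero    f≤g = z≤n
∑-mono (suc n) f≤g = +-mono-≤ (f≤g z<s) (∑-mono n (f≤g ∘ s<s))

∑-+ : ∀ n (f g : ℕ → ℕ) → ∑[ j < n ] (f j + g j) ≡ ∑ n f + ∑ n g
∑-+ zero    f g = refl
∑-+ (suc n) f g = begin
  f 0 + g 0 + ∑[ j < n ] (f (suc j) + g (suc j))  ≡⟨ cong (f 0 + g 0 +_) (∑-+ n (f ∘ suc) (g ∘ suc)) ⟩
  f 0 + g 0 + (∑ n (f ∘ suc) + ∑ n (g ∘ suc))     ≡⟨ interchange (f 0) (g 0) _ _ ⟩
  f 0 + ∑ n (f ∘ suc) + (g 0 + ∑ n (g ∘ suc))     ∎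
  where open ≡-Reasoning

∑-*ˡ : ∀ n c (f : ℕ → ℕ) → ∑[ j < n ] (c * f j) ≡ c * ∑ n f
∑-*ˡ zero    c f = sym (*-zeroʳ c)
∑-*ˡ (suc n) c f = trans (cong (c * f 0 +_) (∑-*ˡ n c (f ∘ suc))) (sym (*-distribˡ-+ c (f 0) _))

∑-const : ∀ n c → ∑[ j < n ] c ≡ n * c
∑-const zero    c = refl
∑-const (suc n) c = cong (c +_) (∑-const n c)

∑-zero : ∀ n {f} → (∀ {j} → j < n → f j ≡ 0) → ∑ n f ≡ 0
∑-zero n {f} f≗0 = trans (∑-cong n f≗0) (trans (∑-const n 0) (*-zeroʳ n))

∑-++ : ∀ k r (f : ℕ → ℕ) → ∑ (k + r) f ≡ ∑ k f + ∑[ j < r ] f (k + j)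
∑-++ zero    r f = refl
∑-++ (suc k) r f = trans (cong (f 0 +_) (∑-++ k r (f ∘ suc))) (sym (+-assoc (f 0) _ _))

∑-split : ∀ {k n} (f : ℕ → ℕ) → k ≤ n → ∑ n f ≡ ∑ k f + ∑[ k ≤ j < n ] f j
∑-split {k} {n} f k≤n = trans (cong (λ m → ∑ m f) (sym (m+[n∸m]≡n k≤n))) (∑-++ k (n ∸ k) f)

δ : ℕ → ℕ → ℕ
δ zero    zero    = 1
δ zero    (suc j) = 0
δ (suc p) zero    = 0
δ (suc p) (suc j) = δ p j

δ-refl : ∀ p → δ p p ≡ 1
δ-refl zero    = refl
δ-refl (suc p) = δ-refl p

δ-≢ : ∀ {p j} → j ≢ p → δ p j ≡ 0
δ-≢ {zero}  {zero}  j≢p = contradiction refl j≢p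
δ-≢ {zero}  {suc j} j≢p = refl
δ-≢ {suc p} {zero}  j≢p = refl
δ-≢ {suc p} {suc j} j≢p = δ-≢ (j≢p ∘ cong suc)

∑-δ : ∀ {p n} → p < n → ∑ n (δ p) ≡ 1
∑-δ {zero}  {suc n} _ = cong suc (∑-zero n (λ _ → refl))
∑-δ {suc p} {suc n} (s<s p<n) = ∑-δ p<n

∑-δ-≥ : ∀ {p n} → n ≤ p → ∑ n (δ p) ≡ 0
∑-δ-≥ {n = n} n≤p = ∑-zero n (λ j<n → δ-≢ (λ j≡p → <⇒≱ j<n (subst (_ ≤_) (sym j≡p) n≤p)))

∑-between-δ : ∀ {k p n} → k ≤ p → p < n → ∑[ k ≤ j < n ] δ p j ≡ 1
∑-between-δ {k} {p} {n} k≤p p<n = begin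
  ∑[ k ≤ j < n ] δ p j                    ≡⟨⟩
  0 + ∑[ k ≤ j < n ] δ p j                ≡⟨ cong (_+ ∑[ k ≤ j < n ] δ p j) (∑-δ-≥ k≤p) ⟨
  ∑ k (δ p) + ∑[ k ≤ j < n ] δ p j        ≡⟨ ∑-split (δ p) (≤-trans k≤p (<⇒≤ p<n)) ⟨
  ∑ n (δ p)                               ≡⟨ ∑-δ p<n ⟩
  1                                       ∎
  where open ≡-Reasoning

∑-between-suc : ∀ {k n} f → k < n → ∑-between k n f ≡ f k + ∑-between (suc k) n f
∑-between-suc {zero}  {suc n} f _         = refl
∑-between-suc {suc k} {suc n} f (s<s k<n) = ∑-between-suc (f ∘ suc) k<n

<∸⇒+< : ∀ k {n j} → j < n ∸ k → k + j < n
<∸⇒+< zero    {n}     j<n   = j<n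
<∸⇒+< (suc k) {suc n} j<n∸k = s<s (<∸⇒+< k j<n∸k)

∑-between-cong : ∀ {k n f g} → (∀ {j} → k ≤ j → j < n → f j ≡ g j) →
                 ∑-between k n f ≡ ∑-between k n g
∑-between-cong {k} {n} f≗g = ∑-cong (n ∸ k) (λ {j} j<n∸k → f≗g (m≤m+n k j) (<∸⇒+< k j<n∸k))

∑-between-mono : ∀ {k n f g} → (∀ {j} → k ≤ j → j < n → f j ≤ g j) →
                 ∑-between k n f ≤ ∑-between k n g
∑-between-mono {k} {n} f≤g = ∑-mono (n ∸ k) (λ {j} j<n∸k → f≤g (m≤m+n k j) (<∸⇒+< k j<n∸k))

term≤∑ : ∀ {p n} f → p < n → f p ≤ ∑ n f
term≤∑ {zero}  {suc n} f _         = m≤m+n (f 0) _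
term≤∑ {suc p} {suc n} f (s<s p<n) = ≤-trans (term≤∑ (f ∘ suc) p<n) (m≤n+m _ (f 0))

term≤∑-between : ∀ {k p n} f → k ≤ p → p < n → f p ≤ ∑-between k n f
term≤∑-between {k} {p} {n} f k≤p p<n =
  subst (_≤ ∑-between k n f) (cong f (m+[n∸m]≡n k≤p))
        (term≤∑ (λ j → f (k + j)) (∸-monoˡ-< p<n k≤p))

sumFin-cong : ∀ n {f g : Fin n → ℕ} → (∀ i → f i ≡ g i) → sumFin n f ≡ sumFin n g
sumFin-cong zero    f≗g = refl
sumFin-cong (suc n) f≗g = cong₂ _+_ (f≗g zero) (sumFin-cong n (f≗g ∘ suc))

sumFin-mono : ∀ n {f g : Fin n → ℕ} → (∀ i → f i ≤ g i) → sumFin n f ≤ sumFin n g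
sumFin-mono zero    f≤g = z≤n
sumFin-mono (suc n) f≤g = +-mono-≤ (f≤g zero) (sumFin-mono n (f≤g ∘ suc))

sumFin-toℕ : ∀ n (f : ℕ → ℕ) → sumFin n (f ∘ toℕ) ≡ ∑ n f
sumFin-toℕ zero    f = refl
sumFin-toℕ (suc n) f = cong (f 0 +_) (sumFin-toℕ n (f ∘ suc))

sumFin-+ : ∀ n (f g : Fin n → ℕ) → sumFin n (λ i → f i + g i) ≡ sumFin n f + sumFin n g
sumFin-+ zero    f g = refl
sumFin-+ (suc n) f g = trans (cong (f zero + g zero +_) (sumFin-+ n (f ∘ suc) (g ∘ suc)))
                             (interchange (f zero) (g zero) _ _)

sumFin-update : ∀ n {f g : Fin n → ℕ} v → (∀ j → j ≢ v → f j ≡ g j) →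
                sumFin n f + g v ≡ sumFin n g + f v
sumFin-update (suc n) {f} {g} zero f≗g =
  trans (cong (λ s → f zero + s + g zero) (sumFin-cong n (λ j → f≗g (suc j) λ ())))
        (xy∙z≈zy∙x (f zero) _ (g zero))
sumFin-update (suc n) {f} {g} (suc v) f≗g = begin
  f zero + sumFin n (f ∘ suc) + g (suc v)     ≡⟨ +-assoc (f zero) _ _ ⟩
  f zero + (sumFin n (f ∘ suc) + g (suc v))   ≡⟨ cong₂ _+_ (f≗g zero λ ()) (sumFin-update n v rest) ⟩
  g zero + (sumFin n (g ∘ suc) + f (suc v))   ≡⟨ +-assoc (g zero) _ _ ⟨
  g zero + sumFin n (g ∘ suc) + f (suc v)     ∎
  where
  open ≡-Reasoning
  rest : ∀ j → j ≢ v → f (suc j) ≡ g (suc j)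
  rest j j≢v = f≗g (suc j) (j≢v ∘ Finₚ.suc-injective)

extend : ∀ {n} → (Fin n → ℕ) → ℕ → ℕ
extend {zero}  d j       = 0
extend {suc n} d zero    = d zero
extend {suc n} d (suc j) = extend (d ∘ suc) j

extend-toℕ : ∀ {n} (d : Fin n → ℕ) i → extend d (toℕ i) ≡ d i
extend-toℕ {suc n} d zero    = refl
extend-toℕ {suc n} d (suc i) = extend-toℕ (d ∘ suc) i

extend-≥ : ∀ {n} (d : Fin n → ℕ) {j} → n ≤ j → extend d j ≡ 0
extend-≥ {zero}  d         _         = refl
extend-≥ {suc n} d {suc j} (s≤s n≤j) = extend-≥ (d ∘ suc) n≤j

extend-< : ∀ {n} (d : Fin n → ℕ) {j} (j<n : j < n) → extend d j ≡ d (fromℕ< j<n)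
extend-< d j<n = trans (cong (extend d) (sym (toℕ-fromℕ< j<n))) (extend-toℕ d (fromℕ< j<n))

extend-all : ∀ {n} {d : Fin n → ℕ} {P : ℕ → Set} → (∀ i → P (d i)) → ∀ {j} → j < n → P (extend d j)
extend-all {d = d} {P} P-d j<n = subst P (sym (extend-< d j<n)) (P-d _)

sumFin-extend : ∀ {n} (d : Fin n → ℕ) → sumFin n d ≡ ∑ n (extend d)
sumFin-extend {n} d = trans (sumFin-cong n (sym ∘ extend-toℕ d)) (sumFin-toℕ n (extend d))

extend-antitone : ∀ {n} {d : Fin n → ℕ} → (∀ i j → i Fin.≤ j → d j ≤ d i) →
                  ∀ {i j} → i ≤ j → extend d j ≤ extend d i
extend-antitone {n} {d} sorted {i} {j} i≤j with j <? n
... | no  j≮n = ≤-trans (≤-reflexive (extend-≥ d (≮⇒≥ j≮n))) z≤n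
... | yes j<n = subst₂ _≤_ (sym (extend-< d j<n)) (sym (extend-< d i<n))
                  (sorted _ _ (subst₂ _≤_ (sym (toℕ-fromℕ< i<n)) (sym (toℕ-fromℕ< j<n)) i≤j))
  where
  i<n : i < n
  i<n = ≤-<-trans i≤j j<n

-- Erdős–Gallai sequences

-- k · (k − 1) is written as k · k with k moved to the left, avoiding truncated subtraction.
ErdősGallai : ℕ → (ℕ → ℕ) → Set
ErdősGallai n d = ∀ {k} → k ≤ n → ∑ k d + k ≤ k * k + ∑[ k ≤ j < n ] (d j ⊓ k)

record EGSequence (n : ℕ) (d : ℕ → ℕ) : Set where
  field
    vanishing : ∀ {j} → n ≤ j → d j ≡ 0
    antitone  : ∀ {i j} → i ≤ j → d j ≤ d i
    even      : 2 ∣ ∑ n d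
    eg        : ErdősGallai n d

eg-above-bound : ∀ {d k c} T → ∑ k d ≤ k * c → c < k → ∑ k d + k ≤ k * k + T
eg-above-bound {d} {k} {c} T ∑≤ c<k = begin
  ∑ k d + k       ≤⟨ +-monoˡ-≤ k ∑≤ ⟩
  k * c + k       ≡⟨ trans (+-comm (k * c) k) (sym (*-suc k c)) ⟩
  k * suc c       ≤⟨ *-monoʳ-≤ k c<k ⟩
  k * k           ≤⟨ m≤m+n (k * k) T ⟩
  k * k + T       ∎
  where open ≤-Reasoning

∑-flat : ∀ {k d D} → (∀ {j} → j < k → d j ≡ D) → ∑ k d ≡ k * D
∑-flat {k} flat = trans (∑-cong k flat) (∑-const k _)

2∣k*k+k : ∀ k → 2 ∣ k * k + k
2∣k*k+k zero    = divides 0 refl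
2∣k*k+k (suc k) with 2∣k*k+k k
... | divides q eq = divides (q + suc k) (begin
  suc k * suc k + suc k   ≡⟨ step k ⟩
  k * k + k + 2 * suc k   ≡⟨ cong (_+ 2 * suc k) eq ⟩
  q * 2 + 2 * suc k       ≡⟨ regroup q k ⟩
  (q + suc k) * 2         ∎)
  where
  open ≡-Reasoning
  step : ∀ k → suc k * suc k + suc k ≡ k * k + k + 2 * suc k
  step = solve-∀
  regroup : ∀ q k → q * 2 + 2 * suc k ≡ (q + suc k) * 2
  regroup = solve-∀

2∤k*k+1+k : ∀ k → 2 ∤ k * k + suc k
2∤k*k+1+k k 2∣ = contradiction (∣1⇒≡1 (∣m+n∣m⇒∣n 2∣k*k+k+1 (2∣k*k+k k))) λ ()
  where
  2∣k*k+k+1 : 2 ∣ k * k + k + 1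
  2∣k*k+k+1 = subst (2 ∣_) (trans (+-suc (k * k) k) (+-comm 1 (k * k + k))) 2∣

min-rescale : ∀ k x → k * (x ⊓ suc k) ≤ suc k * (x ⊓ k)
min-rescale k x with ≤-total x k
... | inj₁ x≤k = begin
  k * (x ⊓ suc k)   ≡⟨ cong (k *_) (m≤n⇒m⊓n≡m (m≤n⇒m≤1+n x≤k)) ⟩
  k * x             ≤⟨ *-monoˡ-≤ x (n≤1+n k) ⟩
  suc k * x         ≡⟨ cong (suc k *_) (m≤n⇒m⊓n≡m x≤k) ⟨
  suc k * (x ⊓ k)   ∎
  where open ≤-Reasoning
... | inj₂ k≤x = begin
  k * (x ⊓ suc k)   ≤⟨ *-monoʳ-≤ k (m⊓n≤n x (suc k)) ⟩
  k * suc k         ≡⟨ *-comm k (suc k) ⟩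
  suc k * k         ≡⟨ cong (suc k *_) (m≥n⇒m⊓n≡n k≤x) ⟨
  suc k * (x ⊓ k)   ∎
  where open ≤-Reasoning

min-rescale-strict : ∀ {k x} → 0 < x → x ≤ k → k * (x ⊓ suc k) + 1 ≤ suc k * (x ⊓ k)
min-rescale-strict {k} {x} 0<x x≤k = begin
  k * (x ⊓ suc k) + 1   ≡⟨ cong (λ y → k * y + 1) (m≤n⇒m⊓n≡m (m≤n⇒m≤1+n x≤k)) ⟩
  k * x + 1             ≡⟨ +-comm (k * x) 1 ⟩
  1 + k * x             ≤⟨ +-monoˡ-≤ (k * x) 0<x ⟩
  suc k * x             ≡⟨ cong (suc k *_) (m≤n⇒m⊓n≡m x≤k) ⟨
  suc k * (x ⊓ k)       ∎
  where open ≤-Reasoning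

eg-next⇒strict : ∀ k D T₁ U → suc k * D + suc k ≤ suc k * suc k + T₁ → k * T₁ + 1 ≤ suc k * U →
                 k * D + suc k ≤ k * k + (k + U)
eg-next⇒strict k D T₁ U eg₁ spread = subst (_≤ k * k + (k + U)) (sym (+-suc (k * D) k))
  (*-cancelˡ-< (suc k) (k * D + k) (k * k + (k + U)) (begin-strict
    suc k * (k * D + k)             ≡⟨ i₁ k D ⟩
    k * (suc k * D + suc k)         <⟨ m<m+n _ z<s ⟩
    k * (suc k * D + suc k) + 1     ≤⟨ +-monoˡ-≤ 1 (*-monoʳ-≤ k eg₁) ⟩
    k * (suc k * suc k + T₁) + 1    ≡⟨ i₂ k T₁ ⟩
    suc k * (k * suc k) + (k * T₁ + 1) ≤⟨ +-monoʳ-≤ (suc k * (k * suc k)) spread ⟩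
    suc k * (k * suc k) + suc k * U ≡⟨ i₃ k U ⟩
    suc k * (k * k + (k + U))       ∎))
  where
  open ≤-Reasoning
  i₁ : ∀ k D → suc k * (k * D + k) ≡ k * (suc k * D + suc k)
  i₁ = solve-∀
  i₂ : ∀ k T₁ → k * (suc k * suc k + T₁) + 1 ≡ suc k * (k * suc k) + (k * T₁ + 1)
  i₂ = solve-∀
  i₃ : ∀ k U → suc k * (k * suc k) + suc k * U ≡ suc k * (k * k + (k + U))
  i₃ = solve-∀

-- The entry m contributes strictly less to the rescaled tail at k + 1 than to the tail at k,
-- which turns the inequality at k + 1 into a strict one at k.
eg-strict : ∀ {n d k D m} → ErdősGallai n d → (∀ {j} → j ≤ k → d j ≡ D) → k < D →
            k < m → m < n → 0 < d m → d m ≤ k →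
            ∑ k d + suc k ≤ k * k + ∑[ k ≤ j < n ] (d j ⊓ k)
eg-strict {n} {d} {k} {D} {m} eg flat k<D k<m m<n 0<dm dm≤k = begin
  ∑ k d + suc k                       ≡⟨ cong (_+ suc k) (∑-flat (flat ∘ <⇒≤)) ⟩
  k * D + suc k                       ≤⟨ eg-next⇒strict k D T₁ U eg₁ spread ⟩
  k * k + (k + U)                     ≡⟨ cong (k * k +_) peel ⟨
  k * k + ∑[ k ≤ j < n ] (d j ⊓ k)    ∎
  where
  open ≤-Reasoning
  U T₁ : ℕ
  U  = ∑[ suc k ≤ j < n ] (d j ⊓ k)
  T₁ = ∑[ suc k ≤ j < n ] (d j ⊓ suc k)
  eg₁ : suc k * D + suc k ≤ suc k * suc k + T₁
  eg₁ = subst (λ L → L + suc k ≤ suc k * suc k + T₁) (∑-flat (flat ∘ s≤s⁻¹)) (eg (<-trans k<m m<n))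
  peel : ∑[ k ≤ j < n ] (d j ⊓ k) ≡ k + U
  peel = trans (∑-between-suc (λ j → d j ⊓ k) (<-trans k<m m<n))
               (cong (_+ U) (m≥n⇒m⊓n≡n (≤-trans (<⇒≤ k<D) (≤-reflexive (sym (flat ≤-refl))))))
  pointwise : ∀ j → k * (d j ⊓ suc k) + δ m j ≤ suc k * (d j ⊓ k)
  pointwise j with j ≟ m
  ... | yes refl = subst (λ e → k * (d m ⊓ suc k) + e ≤ suc k * (d m ⊓ k)) (sym (δ-refl m))
                         (min-rescale-strict 0<dm dm≤k)
  ... | no j≢m   = subst (λ e → k * (d j ⊓ suc k) + e ≤ suc k * (d j ⊓ k)) (sym (δ-≢ j≢m))
                         (subst (_≤ suc k * (d j ⊓ k)) (sym (+-identityʳ _)) (min-rescale k (d j)))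
  spread : k * T₁ + 1 ≤ suc k * U
  spread = begin
    k * T₁ + 1                                            ≡⟨ cong₂ _+_ (∑-*ˡ (n ∸ suc k) k _) (∑-between-δ k<m m<n) ⟨
    ∑[ suc k ≤ j < n ] (k * (d j ⊓ suc k)) + ∑[ suc k ≤ j < n ] δ m j
                                                          ≡⟨ ∑-+ (n ∸ suc k) _ _ ⟨
    ∑[ suc k ≤ j < n ] (k * (d j ⊓ suc k) + δ m j)        ≤⟨ ∑-between-mono {suc k} {n} (λ {j} _ _ → pointwise j) ⟩
    ∑[ suc k ≤ j < n ] (suc k * (d j ⊓ k))                ≡⟨ ∑-*ˡ (n ∸ suc k) (suc k) _ ⟩
    suc k * U                                             ∎

-- A tail of exactly k + 1 would make the degree sum k·k + k + 1 odd.
tail-parity : ∀ {n d k m} → 2 ∣ ∑ n d → (∀ {j} → j ≤ k → d j ≡ k) → k < m → m < n → 0 < d m →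
              suc (suc k) ≤ ∑[ k ≤ j < n ] d j
tail-parity {n} {d} {k} {m} even flat k<m m<n 0<dm = ≤∧≢⇒< tail≥ tail≢
  where
  P : ℕ
  P = ∑[ k ≤ j < n ] d j
  tail≥ : suc k ≤ P
  tail≥ = begin
    suc k                              ≡⟨ +-comm 1 k ⟩
    k + 1                              ≤⟨ +-mono-≤ (≤-reflexive (sym (flat ≤-refl))) 0<dm ⟩
    d k + d m                          ≤⟨ +-monoʳ-≤ (d k) (term≤∑-between d k<m m<n) ⟩
    d k + ∑[ suc k ≤ j < n ] d j        ≡⟨ ∑-between-suc d (<-trans k<m m<n) ⟨
    P                                  ∎
    where open ≤-Reasoning
  tail≢ : suc k ≢ P
  tail≢ P≡1+k = 2∤k*k+1+k k (subst (2 ∣_) (begin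
    ∑ n d            ≡⟨ ∑-split d (≤-trans (<⇒≤ k<m) (<⇒≤ m<n)) ⟩
    ∑ k d + P        ≡⟨ cong₂ _+_ (∑-flat (flat ∘ <⇒≤)) (sym P≡1+k) ⟩
    k * k + suc k    ∎) even)
    where open ≡-Reasoning

crossing : ∀ {P : ℕ → Set} → Decidable P → ∀ n → P 0 → ¬ P n → ∃[ m ] m < n × P m × ¬ P (suc m)
crossing P? zero    p₀ ¬pₙ = contradiction p₀ ¬pₙ
crossing P? (suc n) p₀ ¬pₙ₊₁ with P? n
... | yes pₙ = n , ≤-refl , pₙ , ¬pₙ₊₁
... | no ¬pₙ with crossing P? n p₀ ¬pₙ
...   | m , m<n , pₘ , ¬pₘ₊₁ = m , m<n⇒m<1+n m<n , pₘ , ¬pₘ₊₁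

record Pivots (n : ℕ) (d : ℕ → ℕ) : Set where
  field
    t m       : ℕ
    t<m       : t < m
    m<n       : m < n
    top       : ∀ {j} → j ≤ t → d j ≡ d 0
    below-top : ∀ {j} → t < j → j ≢ m → d j < d 0
    0<d[m]    : 0 < d m
    beyond-m  : ∀ {j} → m < j → d j ≡ 0

eg-at-one : ∀ {n d} → ErdősGallai n d → 1 ≤ n → d 0 ≤ ∑[ 1 ≤ j < n ] (d j ⊓ 1)
eg-at-one {n} {d} eg 1≤n = +-cancelʳ-≤ 1 _ _
  (subst₂ _≤_ (cong (_+ 1) (+-identityʳ (d 0))) (+-comm 1 _) (eg 1≤n))

second-positive : ∀ {n d} → EGSequence n d → 0 < d 0 → 0 < d 1
second-positive {n} {d} egs 0<d₀ with 0 <? d 1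
... | yes 0<d₁ = 0<d₁
... | no ¬0<d₁ = contradiction (≤-trans (eg-at-one eg 1≤n) (≤-reflexive tail≡0)) (<⇒≱ 0<d₀)
  where
  open EGSequence egs
  1≤n : 1 ≤ n
  1≤n = ≰⇒> (λ n≤0 → <⇒≢ 0<d₀ (sym (vanishing n≤0)))
  tail≡0 : ∑[ 1 ≤ j < n ] (d j ⊓ 1) ≡ 0
  tail≡0 = ∑-zero (n ∸ 1) (λ {j} _ → cong (_⊓ 1) (n≤0⇒n≡0 (≤-trans (antitone (s≤s z≤n)) (≮⇒≥ ¬0<d₁))))

pivots : ∀ {n d} → EGSequence n d → 0 < d 0 → Pivots n d
pivots {n} {d} egs 0<d₀ = pivots′ (crossing (λ j → 0 <? d j) n 0<d₀ (λ 0<dₙ → <⇒≢ 0<dₙ (sym (vanishing ≤-refl))))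
  where
  open EGSequence egs
  pivots′ : ∃[ m ] m < n × 0 < d m × ¬ 0 < d (suc m) → Pivots n d
  pivots′ (m , m<n , 0<dₘ , ¬0<dₘ₊₁) =
    pivots″ (crossing (λ j → j <? m ×-dec d 0 ≤? d j) m (0<m , ≤-refl) (λ (m<m , _) → <-irrefl refl m<m))
    where
    beyond-m : ∀ {j} → m < j → d j ≡ 0
    beyond-m m<j = n≤0⇒n≡0 (≤-trans (antitone m<j) (≮⇒≥ ¬0<dₘ₊₁))
    0<m : 0 < m
    0<m = n≢0⇒n>0 (λ m≡0 → ¬0<dₘ₊₁ (subst (λ i → 0 < d (suc i)) (sym m≡0) (second-positive egs 0<d₀)))
    pivots″ : ∃[ t ] t < m × (t < m × d 0 ≤ d t) × ¬ (suc t < m × d 0 ≤ d (suc t)) → Pivots n d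
    pivots″ (t , t<m , (_ , d₀≤dₜ) , ¬P₁₊ₜ) = record
      { t = t ; m = m ; t<m = t<m ; m<n = m<n ; top = top ; below-top = below-top
      ; 0<d[m] = 0<dₘ ; beyond-m = beyond-m }
      where
      top : ∀ {j} → j ≤ t → d j ≡ d 0
      top j≤t = ≤-antisym (antitone z≤n) (≤-trans d₀≤dₜ (antitone j≤t))
      below-top : ∀ {j} → t < j → j ≢ m → d j < d 0
      below-top {j} t<j j≢m with suc t <? m
      ... | yes 1+t<m = ≤-<-trans (antitone t<j) (≰⇒> (λ d₀≤ → ¬P₁₊ₜ (1+t<m , d₀≤)))
      ... | no 1+t≮m  = subst (_< d 0) (sym (beyond-m (≤∧≢⇒< (≤-trans (≮⇒≥ 1+t≮m) t<j) (j≢m ∘ sym)))) 0<d₀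

-- Choudum's lowering step

⊓-+-≤ : ∀ x y k → (x + y) ⊓ k ≤ x ⊓ k + y
⊓-+-≤ x y k = begin
  (x + y) ⊓ k          ≤⟨ ⊓-monoʳ-≤ (x + y) (m≤m+n k y) ⟩
  (x + y) ⊓ (k + y)    ≡⟨ +-distribʳ-⊓ y x k ⟨
  x ⊓ k + y            ∎
  where open ≤-Reasoning

module LayOff {n : ℕ} {d : ℕ → ℕ} (egs : EGSequence n d) (0<d₀ : 0 < d 0) where

  open EGSequence egs
  open Pivots (pivots egs 0<d₀) public

  e : ℕ → ℕ
  e j = δ t j + δ m j

  d′ : ℕ → ℕ
  d′ j = d j ∸ e j

  data Lowering (j : ℕ) : Set where
    kept     : j ≢ t → j ≢ m → Lowering j
    lowered  : j ≡ t ⊎ j ≡ m → Lowering j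

  lowering : ∀ j → Lowering j
  lowering j with j ≟ t | j ≟ m
  ... | yes j≡t | _       = lowered (inj₁ j≡t)
  ... | no _    | yes j≡m = lowered (inj₂ j≡m)
  ... | no j≢t  | no j≢m  = kept j≢t j≢m

  t≢m : t ≢ m
  t≢m = <⇒≢ t<m

  e-kept : ∀ {j} → j ≢ t → j ≢ m → e j ≡ 0
  e-kept j≢t j≢m = cong₂ _+_ (δ-≢ j≢t) (δ-≢ j≢m)

  e-lowered : ∀ {j} → j ≡ t ⊎ j ≡ m → e j ≡ 1
  e-lowered (inj₁ refl) = cong₂ _+_ (δ-refl t) (δ-≢ t≢m)
  e-lowered (inj₂ refl) = cong₂ _+_ (δ-≢ (t≢m ∘ sym)) (δ-refl m)

  d′-kept : ∀ {j} → j ≢ t → j ≢ m → d′ j ≡ d j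
  d′-kept {j} j≢t j≢m = cong (d j ∸_) (e-kept j≢t j≢m)

  0<d-lowered : ∀ {j} → j ≡ t ⊎ j ≡ m → 0 < d j
  0<d-lowered (inj₁ refl) = subst (0 <_) (sym (top ≤-refl)) 0<d₀
  0<d-lowered (inj₂ refl) = 0<d[m]

  d′-lowered : ∀ {j} → j ≡ t ⊎ j ≡ m → suc (d′ j) ≡ d j
  d′-lowered {j} j∈ = trans (cong (λ x → suc (d j ∸ x)) (e-lowered j∈)) (trans (+-comm 1 _) (m∸n+n≡m (0<d-lowered j∈)))

  d′+e : ∀ j → d′ j + e j ≡ d j
  d′+e j with lowering j
  ... | kept j≢t j≢m = trans (cong₂ _+_ (d′-kept j≢t j≢m) (e-kept j≢t j≢m)) (+-identityʳ (d j))
  ... | lowered j∈   = trans (cong (d′ j +_) (e-lowered j∈)) (trans (+-comm (d′ j) 1) (d′-lowered j∈))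

  ∑-e : ∑ n e ≡ 2
  ∑-e = trans (∑-+ n (δ t) (δ m)) (cong₂ _+_ (∑-δ (<-trans t<m m<n)) (∑-δ m<n))

  ∑-e-split : ∀ {k} → k ≤ n → ∑ k e + ∑[ k ≤ j < n ] e j ≡ 2
  ∑-e-split k≤n = trans (sym (∑-split e k≤n)) ∑-e

  head-split : ∀ k → ∑ k d′ + ∑ k e ≡ ∑ k d
  head-split k = trans (sym (∑-+ k d′ e)) (∑-cong k (λ {j} _ → d′+e j))

  ∑-d′ : 2 + ∑ n d′ ≡ ∑ n d
  ∑-d′ = trans (+-comm 2 (∑ n d′)) (trans (cong (∑ n d′ +_) (sym ∑-e)) (head-split n))

  tail-min-≤ : ∀ k → ∑[ k ≤ j < n ] (d j ⊓ k) ≤ ∑[ k ≤ j < n ] (d′ j ⊓ k) + ∑[ k ≤ j < n ] e j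
  tail-min-≤ k = begin
    ∑[ k ≤ j < n ] (d j ⊓ k)
      ≡⟨ ∑-between-cong {k} {n} (λ {j} _ _ → cong (_⊓ k) (sym (d′+e j))) ⟩
    ∑[ k ≤ j < n ] ((d′ j + e j) ⊓ k)
      ≤⟨ ∑-between-mono {k} {n} (λ {j} _ _ → ⊓-+-≤ (d′ j) (e j) k) ⟩
    ∑[ k ≤ j < n ] (d′ j ⊓ k + e j)                       ≡⟨ ∑-+ (n ∸ k) _ _ ⟩
    ∑[ k ≤ j < n ] (d′ j ⊓ k) + ∑[ k ≤ j < n ] e j        ∎
    where open ≤-Reasoning

  strict-drop : ∀ {i j} → i < j → i ≡ t ⊎ i ≡ m → j ≢ t → j ≢ m → d j < d i
  strict-drop i<j (inj₁ refl) j≢t j≢m = subst (d _ <_) (sym (top ≤-refl)) (below-top i<j j≢m)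
  strict-drop i<j (inj₂ refl) j≢t j≢m = subst (_< d m) (sym (beyond-m i<j)) 0<d[m]

  antitone′ : ∀ {i j} → i ≤ j → d′ j ≤ d′ i
  antitone′ {i} {j} i≤j with lowering i | lowering j
  ... | kept i≢t i≢m | _           =
    subst (d′ j ≤_) (sym (d′-kept i≢t i≢m)) (≤-trans (m∸n≤m (d j) (e j)) (antitone i≤j))
  ... | lowered i∈   | lowered j∈  = s≤s⁻¹ (subst₂ _≤_ (sym (d′-lowered j∈)) (sym (d′-lowered i∈)) (antitone i≤j))
  ... | lowered i∈   | kept j≢t j≢m =
    s≤s⁻¹ (subst₂ _≤_ (cong suc (sym (d′-kept j≢t j≢m))) (sym (d′-lowered i∈)) (strict-drop i<j i∈ j≢t j≢m))
    where
    i<j : i < j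
    i<j = ≤∧≢⇒< i≤j λ { refl → [ j≢t , j≢m ]′ i∈ }

  even′ : 2 ∣ ∑ n d′
  even′ = ∣m+n∣m⇒∣n (subst (2 ∣_) (sym ∑-d′) even) ∣-refl

  eg′-beyond-t : ∀ {k} → t < k → k ≤ n → ∑ k d′ + k ≤ k * k + ∑[ k ≤ j < n ] (d′ j ⊓ k)
  eg′-beyond-t {k} t<k k≤n = +-cancelʳ-≤ Eₕ _ _ (begin
    ∑ k d′ + k + Eₕ                ≡⟨ xy∙z≈xz∙y (∑ k d′) k Eₕ ⟩
    ∑ k d′ + Eₕ + k                ≡⟨ cong (_+ k) (head-split k) ⟩
    ∑ k d + k                      ≤⟨ eg k≤n ⟩
    k * k + ∑[ k ≤ j < n ] (d j ⊓ k) ≤⟨ +-monoʳ-≤ (k * k) (tail-min-≤ k) ⟩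
    k * k + (T′ + Eₜ)              ≤⟨ +-monoʳ-≤ (k * k) (+-monoʳ-≤ T′ Eₜ≤Eₕ) ⟩
    k * k + (T′ + Eₕ)              ≡⟨ +-assoc (k * k) T′ Eₕ ⟨
    k * k + T′ + Eₕ                ∎)
    where
    open ≤-Reasoning
    Eₕ Eₜ T′ : ℕ
    Eₕ = ∑ k e
    Eₜ = ∑[ k ≤ j < n ] e j
    T′ = ∑[ k ≤ j < n ] (d′ j ⊓ k)
    1≤Eₕ : 1 ≤ Eₕ
    1≤Eₕ = ≤-trans (≤-reflexive (sym (∑-δ t<k))) (∑-mono k (λ {j} _ → m≤m+n (δ t j) (δ m j)))
    -- t < k puts at least one of the two lowered entries into the head.
    Eₜ≤Eₕ : Eₜ ≤ Eₕ
    Eₜ≤Eₕ = ≤-trans (+-cancelˡ-≤ 1 Eₜ 1 (≤-trans (+-monoˡ-≤ Eₜ 1≤Eₕ) (≤-reflexive (∑-e-split k≤n))))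
                    1≤Eₕ

  e≤1 : ∀ j → e j ≤ 1
  e≤1 j with lowering j
  ... | kept j≢t j≢m = ≤-trans (≤-reflexive (e-kept j≢t j≢m)) z≤n
  ... | lowered j∈   = ≤-reflexive (e-lowered j∈)

  min-preserved : ∀ {j k} → k < d j → d j ⊓ k ≤ d′ j ⊓ k
  min-preserved {j} {k} k<dⱼ = begin
    d j ⊓ k     ≤⟨ m⊓n≤n (d j) k ⟩
    k           ≡⟨ m≥n⇒m⊓n≡n k≤d′ⱼ ⟨
    d′ j ⊓ k    ∎
    where
    open ≤-Reasoning
    k≤d′ⱼ : k ≤ d′ j
    k≤d′ⱼ = ≤-trans (∸-monoˡ-≤ 1 k<dⱼ) (∸-monoʳ-≤ (d j) (e≤1 j))

  module UpToT {k : ℕ} (k≤t : k ≤ t) where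

    k<m : k < m
    k<m = ≤-<-trans k≤t t<m

    k≤n : k ≤ n
    k≤n = ≤-trans (<⇒≤ k<m) (<⇒≤ m<n)

    flat : ∀ {j} → j ≤ k → d j ≡ d 0
    flat j≤k = top (≤-trans j≤k k≤t)

    Eₕ≡0 : ∑ k e ≡ 0
    Eₕ≡0 = trans (∑-+ k (δ t) (δ m)) (cong₂ _+_ (∑-δ-≥ k≤t) (∑-δ-≥ (<⇒≤ k<m)))

    Eₜ≡2 : ∑[ k ≤ j < n ] e j ≡ 2
    Eₜ≡2 = trans (cong (_+ ∑[ k ≤ j < n ] e j) (sym Eₕ≡0)) (∑-e-split k≤n)

    head-same : ∑ k d′ ≡ ∑ k d
    head-same = trans (sym (trans (cong (∑ k d′ +_) Eₕ≡0) (+-identityʳ _))) (head-split k)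

    head-flat : ∑ k d′ ≡ k * d 0
    head-flat = trans head-same (∑-flat (flat ∘ <⇒≤))

    eg′-when-d₀≡k : d 0 ≡ k → ∑ k d′ + k ≤ k * k + ∑[ k ≤ j < n ] (d′ j ⊓ k)
    eg′-when-d₀≡k d₀≡k = begin
      ∑ k d′ + k                       ≡⟨ cong (λ x → x + k) (trans head-flat (cong (k *_) d₀≡k)) ⟩
      k * k + k                        ≤⟨ +-monoʳ-≤ (k * k) k≤P′ ⟩
      k * k + P′                       ≡⟨ cong (k * k +_) T′≡P′ ⟨
      k * k + ∑[ k ≤ j < n ] (d′ j ⊓ k) ∎
      where
      open ≤-Reasoning
      P′ : ℕ
      P′ = ∑[ k ≤ j < n ] d′ j
      T′≡P′ : ∑[ k ≤ j < n ] (d′ j ⊓ k) ≡ P′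
      T′≡P′ = ∑-between-cong {k} {n} λ {j} _ _ →
        m≤n⇒m⊓n≡m (≤-trans (m∸n≤m (d j) (e j)) (≤-trans (antitone z≤n) (≤-reflexive d₀≡k)))
      P′+2≡P : P′ + 2 ≡ ∑[ k ≤ j < n ] d j
      P′+2≡P = begin-equality
        P′ + 2                                   ≡⟨ cong (P′ +_) Eₜ≡2 ⟨
        P′ + ∑[ k ≤ j < n ] e j                  ≡⟨ ∑-+ (n ∸ k) _ _ ⟨
        ∑[ k ≤ j < n ] (d′ j + e j)              ≡⟨ ∑-between-cong {k} {n} (λ {j} _ _ → d′+e j) ⟩
        ∑[ k ≤ j < n ] d j                       ∎
      k≤P′ : k ≤ P′
      k≤P′ = +-cancelʳ-≤ 2 k P′ (subst₂ _≤_ (+-comm 2 k) (sym P′+2≡P)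
               (tail-parity even (λ j≤k → trans (flat j≤k) d₀≡k) k<m m<n 0<d[m]))

    eg′-when-k<dₘ : k < d 0 → k < d m → ∑ k d′ + k ≤ k * k + ∑[ k ≤ j < n ] (d′ j ⊓ k)
    eg′-when-k<dₘ k<d₀ k<dₘ = begin
      ∑ k d′ + k                          ≡⟨ cong (_+ k) head-same ⟩
      ∑ k d + k                           ≤⟨ eg k≤n ⟩
      k * k + ∑[ k ≤ j < n ] (d j ⊓ k)    ≤⟨ +-monoʳ-≤ (k * k) (∑-between-mono {k} {n} (λ {j} _ _ → pointwise j)) ⟩
      k * k + ∑[ k ≤ j < n ] (d′ j ⊓ k)   ∎
      where
      open ≤-Reasoning
      pointwise : ∀ j → d j ⊓ k ≤ d′ j ⊓ k
      pointwise j with lowering j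
      ... | kept j≢t j≢m        = ≤-reflexive (cong (_⊓ k) (sym (d′-kept j≢t j≢m)))
      ... | lowered (inj₁ refl) = min-preserved (subst (k <_) (sym (top ≤-refl)) k<d₀)
      ... | lowered (inj₂ refl) = min-preserved k<dₘ

    eg′-when-dₘ≤k : k < d 0 → d m ≤ k → ∑ k d′ + k ≤ k * k + ∑[ k ≤ j < n ] (d′ j ⊓ k)
    eg′-when-dₘ≤k k<d₀ dₘ≤k = +-cancelʳ-≤ 1 _ _ (begin
      ∑ k d′ + k + 1                          ≡⟨ trans (+-assoc (∑ k d′) k 1) (cong₂ _+_ head-same (+-comm k 1)) ⟩
      ∑ k d + suc k                           ≤⟨ eg-strict eg flat k<d₀ k<m m<n 0<d[m] dₘ≤k ⟩
      k * k + ∑[ k ≤ j < n ] (d j ⊓ k)        ≤⟨ +-monoʳ-≤ (k * k) T≤T′+1 ⟩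
      k * k + (T′ + 1)                        ≡⟨ +-assoc (k * k) T′ 1 ⟨
      k * k + T′ + 1                          ∎)
      where
      open ≤-Reasoning
      T′ : ℕ
      T′ = ∑[ k ≤ j < n ] (d′ j ⊓ k)
      pointwise : ∀ j → d j ⊓ k ≤ d′ j ⊓ k + δ m j
      pointwise j with lowering j
      ... | kept j≢t j≢m        = ≤-trans (≤-reflexive (cong (_⊓ k) (sym (d′-kept j≢t j≢m)))) (m≤m+n _ _)
      ... | lowered (inj₁ refl) = ≤-trans (min-preserved (subst (k <_) (sym (top ≤-refl)) k<d₀)) (m≤m+n _ _)
      ... | lowered (inj₂ refl) = subst₂ (λ x y → x ⊓ k ≤ d′ m ⊓ k + y)
                                    (trans (+-comm (d′ m) 1) (d′-lowered (inj₂ refl))) (sym (δ-refl m))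
                                    (⊓-+-≤ (d′ m) 1 k)
      T≤T′+1 : ∑[ k ≤ j < n ] (d j ⊓ k) ≤ T′ + 1
      T≤T′+1 = begin
        ∑[ k ≤ j < n ] (d j ⊓ k)                         ≤⟨ ∑-between-mono {k} {n} (λ {j} _ _ → pointwise j) ⟩
        ∑[ k ≤ j < n ] (d′ j ⊓ k + δ m j)                ≡⟨ ∑-+ (n ∸ k) _ _ ⟩
        T′ + ∑[ k ≤ j < n ] δ m j                        ≡⟨ cong (T′ +_) (∑-between-δ (<⇒≤ k<m) m<n) ⟩
        T′ + 1                                           ∎

    eg′-up-to-t : ∑ k d′ + k ≤ k * k + ∑[ k ≤ j < n ] (d′ j ⊓ k)
    eg′-up-to-t with <-cmp (d 0) k
    ... | tri< d₀<k _ _ = eg-above-bound _ (≤-reflexive head-flat) d₀<k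
    ... | tri≈ _ d₀≡k _ = eg′-when-d₀≡k d₀≡k
    ... | tri> _ _ k<d₀ with d m ≤? k
    ...   | yes dₘ≤k = eg′-when-dₘ≤k k<d₀ dₘ≤k
    ...   | no  dₘ≰k = eg′-when-k<dₘ k<d₀ (≰⇒> dₘ≰k)

  eg′ : ErdősGallai n d′
  eg′ {k} k≤n with k ≤? t
  ... | yes k≤t = UpToT.eg′-up-to-t k≤t
  ... | no  k≰t = eg′-beyond-t (≰⇒> k≰t) k≤n

  vanishing′ : ∀ {j} → n ≤ j → d′ j ≡ 0
  vanishing′ {j} n≤j = trans (cong (_∸ e j) (vanishing n≤j)) (0∸n≡0 (e j))

  lowered-sequence : EGSequence n d′
  lowered-sequence = record { vanishing = vanishing′ ; antitone = antitone′ ; even = even′ ; eg = eg′ }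

-- Editing simple graphs

𝟙 : Bool → ℕ
𝟙 b = if b then 1 else 0

module _ {n : ℕ} where

  isPair : (u v i j : Fin n) → Bool
  isPair u v i j = does (i Fin.≟ u) ∧ does (j Fin.≟ v) ∨ does (i Fin.≟ v) ∧ does (j Fin.≟ u)

  isPair-sym : ∀ u v i j → isPair u v i j ≡ isPair u v j i
  isPair-sym u v i j = trans (cong₂ _∨_ (∧-comm (does (i Fin.≟ u)) _) (∧-comm (does (i Fin.≟ v)) _))
                             (∨-comm (does (j Fin.≟ v) ∧ does (i Fin.≟ u)) _)

  isPair-flip : ∀ u v i j → isPair u v i j ≡ isPair v u i j
  isPair-flip u v i j = ∨-comm (does (i Fin.≟ u) ∧ does (j Fin.≟ v)) _

  isPair-loop : ∀ {u v} i → u ≢ v → isPair u v i i ≡ false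
  isPair-loop {u} {v} i u≢v with i Fin.≟ u | i Fin.≟ v
  ... | yes refl | yes refl = contradiction refl u≢v
  ... | yes _    | no _     = refl
  ... | no _     | yes _    = refl
  ... | no _     | no _     = refl

  isPair-end : ∀ {u v} j → u ≢ v → isPair u v u j ≡ does (j Fin.≟ v)
  isPair-end {u} {v} j u≢v rewrite dec-true (u Fin.≟ u) refl | dec-false (u Fin.≟ v) u≢v = ∨-identityʳ _

  isPair-away : ∀ {u v i} j → i ≢ u → i ≢ v → isPair u v i j ≡ false
  isPair-away {u} {v} {i} j i≢u i≢v rewrite dec-false (i Fin.≟ u) i≢u | dec-false (i Fin.≟ v) i≢v = refl

  setEdge : (G : SimpleGraph n) (u v : Fin n) → u ≢ v → Bool → SimpleGraph n
  setEdge G u v u≢v b = record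
    { adj       = λ i j → if isPair u v i j then b else adj G i j
    ; symmetric = λ i j → cong₂ (λ p a → if p then b else a) (isPair-sym u v i j) (symmetric G i j)
    ; loopless  = λ i → trans (cong (λ p → if p then b else adj G i i) (isPair-loop i u≢v)) (loopless G i)
    }

  ends : (u v i : Fin n) → ℕ
  ends u v i = δ (toℕ u) (toℕ i) + δ (toℕ v) (toℕ i)

  δ-toℕ-≢ : ∀ {u i : Fin n} → i ≢ u → δ (toℕ u) (toℕ i) ≡ 0
  δ-toℕ-≢ i≢u = δ-≢ (i≢u ∘ toℕ-injective)

  ends-away : ∀ {u v i} → i ≢ u → i ≢ v → ends u v i ≡ 0
  ends-away i≢u i≢v = cong₂ _+_ (δ-toℕ-≢ i≢u) (δ-toℕ-≢ i≢v)

  ends-start : ∀ {u v} → u ≢ v → ends u v u ≡ 1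
  ends-start {u} u≢v = cong₂ _+_ (δ-refl (toℕ u)) (δ-toℕ-≢ u≢v)

  ends-end : ∀ {u v} → u ≢ v → ends u v v ≡ 1
  ends-end {u} {v} u≢v = cong₂ _+_ (δ-toℕ-≢ (u≢v ∘ sym)) (δ-refl (toℕ v))

  module _ (G : SimpleGraph n) {u v : Fin n} (u≢v : u ≢ v) (b : Bool) where

    private
      G′ : SimpleGraph n
      G′ = setEdge G u v u≢v b

    degree-setEdge-start : degree G′ u + 𝟙 (adj G u v) ≡ degree G u + 𝟙 b
    degree-setEdge-start = trans (sumFin-update n v row-same)
      (cong (λ p → degree G u + 𝟙 (if p then b else adj G u v)) (trans (isPair-end v u≢v) (dec-true (v Fin.≟ v) refl)))
      where
      row-same : ∀ j → j ≢ v → 𝟙 (adj G′ u j) ≡ 𝟙 (adj G u j)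
      row-same j j≢v = cong (λ p → 𝟙 (if p then b else adj G u j)) (trans (isPair-end j u≢v) (dec-false (j Fin.≟ v) j≢v))

    degree-setEdge-flip : ∀ i → degree G′ i ≡ degree (setEdge G v u (u≢v ∘ sym) b) i
    degree-setEdge-flip i = sumFin-cong n (λ j → cong (λ p → 𝟙 (if p then b else adj G i j)) (isPair-flip u v i j))

    degree-setEdge-away : ∀ {i} → i ≢ u → i ≢ v → degree G′ i ≡ degree G i
    degree-setEdge-away {i} i≢u i≢v =
      sumFin-cong n (λ j → cong (λ p → 𝟙 (if p then b else adj G i j)) (isPair-away j i≢u i≢v))

  private
    once : ∀ {x y a c e} → e ≡ 1 → x + a ≡ y + c → x + e * a ≡ y + e * c
    once {x} {y} {a} {c} refl eq = trans (cong (x +_) (*-identityˡ a)) (trans eq (cong (y +_) (sym (*-identityˡ c))))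

    never : ∀ {x y a c e} → e ≡ 0 → x ≡ y → x + e * a ≡ y + e * c
    never refl eq = cong (_+ 0) eq

  degree-setEdge : ∀ G {u v} (u≢v : u ≢ v) b i →
    degree (setEdge G u v u≢v b) i + ends u v i * 𝟙 (adj G u v) ≡ degree G i + ends u v i * 𝟙 b
  degree-setEdge G {u} {v} u≢v b i = by-cases (i Fin.≟ u) (i Fin.≟ v)
    where
    by-cases : Dec (i ≡ u) → Dec (i ≡ v) →
      degree (setEdge G u v u≢v b) i + ends u v i * 𝟙 (adj G u v) ≡ degree G i + ends u v i * 𝟙 b
    by-cases (yes refl) _          = once (ends-start u≢v) (degree-setEdge-start G u≢v b)
    by-cases (no _)     (yes refl) = once (ends-end u≢v) (begin
      degree (setEdge G u v u≢v b) v + 𝟙 (adj G u v)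
        ≡⟨ cong₂ (λ x a → x + 𝟙 a) (degree-setEdge-flip G u≢v b v) (symmetric G u v) ⟩
      degree (setEdge G v u (u≢v ∘ sym) b) v + 𝟙 (adj G v u)    ≡⟨ degree-setEdge-start G (u≢v ∘ sym) b ⟩
      degree G v + 𝟙 b                                          ∎)
      where open ≡-Reasoning
    by-cases (no i≢u)   (no i≢v)   = never (ends-away i≢u i≢v) (degree-setEdge-away G u≢v b i≢u i≢v)

  degree-addEdge : ∀ G {u v} (u≢v : u ≢ v) → adj G u v ≡ false → ∀ i →
                   degree (setEdge G u v u≢v true) i ≡ degree G i + ends u v i
  degree-addEdge G {u} {v} u≢v uv∉ i = begin
    degree G′ i                                   ≡⟨ +-identityʳ _ ⟨
    degree G′ i + 0                               ≡⟨ cong (degree G′ i +_) (*-zeroʳ (ends u v i)) ⟨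
    degree G′ i + ends u v i * 𝟙 false            ≡⟨ cong (λ a → degree G′ i + ends u v i * 𝟙 a) uv∉ ⟨
    degree G′ i + ends u v i * 𝟙 (adj G u v)      ≡⟨ degree-setEdge G u≢v true i ⟩
    degree G i + ends u v i * 1                   ≡⟨ cong (degree G i +_) (*-identityʳ _) ⟩
    degree G i + ends u v i                       ∎
    where
    open ≡-Reasoning
    G′ : SimpleGraph n
    G′ = setEdge G u v u≢v true

  degree-removeEdge : ∀ G {u v} (u≢v : u ≢ v) → adj G u v ≡ true → ∀ i →
                      degree (setEdge G u v u≢v false) i + ends u v i ≡ degree G i
  degree-removeEdge G {u} {v} u≢v uv∈ i = begin
    degree G′ i + ends u v i                      ≡⟨ cong (degree G′ i +_) (*-identityʳ _) ⟨
    degree G′ i + ends u v i * 𝟙 true             ≡⟨ cong (λ a → degree G′ i + ends u v i * 𝟙 a) uv∈ ⟨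
    degree G′ i + ends u v i * 𝟙 (adj G u v)      ≡⟨ degree-setEdge G u≢v false i ⟩
    degree G i + ends u v i * 0                   ≡⟨ cong (degree G i +_) (*-zeroʳ (ends u v i)) ⟩
    degree G i + 0                                ≡⟨ +-identityʳ _ ⟩
    degree G i                                    ∎
    where
    open ≡-Reasoning
    G′ : SimpleGraph n
    G′ = setEdge G u v u≢v false

  removeEdge-nonadjacent : ∀ G {u v} (u≢v : u ≢ v) {i j} → adj G i j ≡ false → adj (setEdge G u v u≢v false) i j ≡ false
  removeEdge-nonadjacent G {u} {v} u≢v {i} {j} ij∉ with isPair u v i j
  ... | true  = refl
  ... | false = ij∉

  sumFin-δ : ∀ (u : Fin n) → sumFin n (λ i → δ (toℕ u) (toℕ i)) ≡ 1
  sumFin-δ u = trans (sumFin-toℕ n (δ (toℕ u))) (∑-δ (toℕ<n u))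

  -- Otherwise N(x) ∖ {v} ⊆ N(v) ∖ {u}, so deg x ≤ deg v.
  private-neighbour : ∀ G {u v x : Fin n} → adj G v u ≡ true → adj G x u ≡ false → degree G v < degree G x →
                      ∃[ y ] adj G x y ≡ true × adj G v y ≡ false × y ≢ v
  private-neighbour G {u} {v} {x} vu∈ xu∉ dᵥ<dₓ
    with any? (λ y → (adj G x y Bool.≟ true) ×-dec (adj G v y Bool.≟ false) ×-dec ¬? (y Fin.≟ v))
  ... | yes found = found
  ... | no  none  = contradiction dᵥ<dₓ (≤⇒≯ (+-cancelʳ-≤ 1 _ _ counted))
    where
    unshared : ∀ y → y ≢ u → 𝟙 (adj G x y) ≤ 𝟙 (adj G v y) + δ (toℕ v) (toℕ y)
    unshared y y≢u with adj G x y in xy | adj G v y in vy | y Fin.≟ v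
    ... | false | _     | _        = z≤n
    ... | true  | true  | _        = s≤s z≤n
    ... | true  | false | yes refl = ≤-reflexive (sym (δ-refl (toℕ y)))
    ... | true  | false | no y≢v   = contradiction (y , xy , vy , y≢v) none
    pointwise : ∀ y → 𝟙 (adj G x y) + δ (toℕ u) (toℕ y) ≤ 𝟙 (adj G v y) + δ (toℕ v) (toℕ y)
    pointwise y with y Fin.≟ u
    ... | yes refl rewrite xu∉ | vu∈ | δ-refl (toℕ y) = s≤s z≤n
    ... | no y≢u   rewrite δ-toℕ-≢ y≢u | +-identityʳ (𝟙 (adj G x y)) = unshared y y≢u
    counted : degree G x + 1 ≤ degree G v + 1
    counted = subst₂ _≤_ (trans (sumFin-+ n _ _) (cong (degree G x +_) (sumFin-δ u)))
                         (trans (sumFin-+ n _ _) (cong (degree G v +_) (sumFin-δ v)))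
                         (sumFin-mono n pointwise)

  Realises : SimpleGraph n → (Fin n → ℕ) → Set
  Realises G d = ∀ i → degree G i ≡ d i

  add-edge-or-switch : ∀ {G d u v} → Realises G d → (u≢v : u ≢ v) →
             (adj G u v ≡ true → ∃[ x ] x ≢ u × x ≢ v × adj G u x ≡ false × d v < d x) →
             Graphic (λ i → d i + ends u v i)
  add-edge-or-switch {G} {d} {u} {v} realises u≢v switchable with adj G u v in uv
  ... | false = setEdge G u v u≢v true , λ i → trans (degree-addEdge G u≢v uv i) (cong (_+ ends u v i) (realises i))
  ... | true  = two-switch (switchable refl)
    where
    two-switch : ∃[ x ] x ≢ u × x ≢ v × adj G u x ≡ false × d v < d x → Graphic (λ i → d i + ends u v i)
    two-switch (x , x≢u , x≢v , ux∉ , dᵥ<dₓ) =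
      switch-through (private-neighbour G (trans (symmetric G v u) uv) (trans (symmetric G x u) ux∉)
                                         (subst₂ _<_ (sym (realises v)) (sym (realises x)) dᵥ<dₓ))
      where
      switch-through : ∃[ y ] adj G x y ≡ true × adj G v y ≡ false × y ≢ v → Graphic (λ i → d i + ends u v i)
      switch-through (y , xy∈ , vy∉ , y≢v) = G₃ , degrees
        where
        x≢y : x ≢ y
        x≢y x≡y = contradiction (trans (sym xy∈) (trans (cong (adj G x) (sym x≡y)) (loopless G x))) λ ()
        G₁ G₂ G₃ : SimpleGraph n
        G₁ = setEdge G x y x≢y false
        G₂ = setEdge G₁ u x (x≢u ∘ sym) true
        G₃ = setEdge G₂ v y (y≢v ∘ sym) true
        vy∉₂ : adj G₂ v y ≡ false
        vy∉₂ = trans (cong (λ p → if p then true else adj G₁ v y) (isPair-away y (u≢v ∘ sym) (x≢v ∘ sym)))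
                     (removeEdge-nonadjacent G x≢y vy∉)
        degrees : ∀ i → degree G₃ i ≡ d i + ends u v i
        degrees i = begin
          degree G₃ i                                  ≡⟨ degree-addEdge G₂ (y≢v ∘ sym) vy∉₂ i ⟩
          degree G₂ i + ends v y i
            ≡⟨ cong (_+ ends v y i) (degree-addEdge G₁ (x≢u ∘ sym) (removeEdge-nonadjacent G x≢y ux∉) i) ⟩
          degree G₁ i + ends u x i + ends v y i
            ≡⟨ regroup (degree G₁ i) (δ (toℕ u) (toℕ i)) (δ (toℕ x) (toℕ i)) (δ (toℕ v) (toℕ i)) (δ (toℕ y) (toℕ i)) ⟩
          degree G₁ i + ends x y i + ends u v i
            ≡⟨ cong (_+ ends u v i) (trans (degree-removeEdge G x≢y xy∈ i) (realises i)) ⟩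
          d i + ends u v i                             ∎
          where
          open ≡-Reasoning
          regroup : ∀ D a b c e → D + (a + b) + (c + e) ≡ D + (b + e) + (a + c)
          regroup = solve-∀

-- The Erdős–Gallai theorem

module Realisation {n : ℕ} {d : ℕ → ℕ} (egs : EGSequence n d) (0<d₀ : 0 < d 0) where

  open EGSequence egs
  open LayOff egs 0<d₀

  t<n : t < n
  t<n = <-trans t<m m<n

  vt vm : Fin n
  vt = fromℕ< t<n
  vm = fromℕ< m<n

  vt≢vm : vt ≢ vm
  vt≢vm vt≡vm = t≢m (trans (sym (toℕ-fromℕ< t<n)) (trans (cong toℕ vt≡vm) (toℕ-fromℕ< m<n)))

  module _ (G′ : SimpleGraph n) (realises′ : Realises G′ (d′ ∘ toℕ)) where

    -- Otherwise t is adjacent to every other positive vertex, so deg t ≥ d 0 by the Erdős–Gallai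
    -- inequality at k = 1, whereas deg t = d 0 − 1.
    top-misses-positive : ∃[ x ] x ≢ vt × 0 < d (toℕ x) × adj G′ vt x ≡ false
    top-misses-positive
      with any? (λ x → ¬? (x Fin.≟ vt) ×-dec (0 <? d (toℕ x)) ×-dec (adj G′ vt x Bool.≟ false))
    ... | yes found = found
    ... | no  none  = contradiction (≤-trans top-bound (≤-reflexive degree-top)) (<⇒≱ (n<1+n (d 0)))
      where
      pointwise : ∀ x → d (toℕ x) ⊓ 1 ≤ 𝟙 (adj G′ vt x) + δ (toℕ vt) (toℕ x)
      pointwise x with x Fin.≟ vt | 0 <? d (toℕ x) | adj G′ vt x in tx
      ... | yes refl | _       | _     = ≤-trans (m⊓n≤n _ 1) (≤-trans (≤-reflexive (sym (δ-refl (toℕ vt)))) (m≤n+m _ _))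
      ... | no _     | no ¬0<d | _     = ≤-trans (≤-reflexive (cong (_⊓ 1) (n≤0⇒n≡0 (≮⇒≥ ¬0<d)))) z≤n
      ... | no _     | yes _   | true  = ≤-trans (m⊓n≤n _ 1) (m≤m+n 1 _)
      ... | no x≢vt  | yes 0<d | false = contradiction (x , x≢vt , 0<d , tx) none
      top-bound : suc (d 0) ≤ degree G′ vt + 1
      top-bound = begin
        1 + d 0                                               ≤⟨ +-monoʳ-≤ 1 (eg-at-one eg (≤-<-trans z≤n t<n)) ⟩
        1 + ∑[ 1 ≤ j < n ] (d j ⊓ 1)
          ≡⟨ cong (λ x → x + 0 + ∑[ 1 ≤ j < n ] (d j ⊓ 1)) (m≥n⇒m⊓n≡n 0<d₀) ⟨
        ∑ 1 (λ j → d j ⊓ 1) + ∑[ 1 ≤ j < n ] (d j ⊓ 1)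
          ≡⟨ ∑-split (λ j → d j ⊓ 1) (≤-<-trans z≤n t<n) ⟨
        ∑ n (λ j → d j ⊓ 1)                                   ≡⟨ sumFin-toℕ n (λ j → d j ⊓ 1) ⟨
        sumFin n (λ x → d (toℕ x) ⊓ 1)                        ≤⟨ sumFin-mono n pointwise ⟩
        sumFin n (λ x → 𝟙 (adj G′ vt x) + δ (toℕ vt) (toℕ x))  ≡⟨ sumFin-+ n _ _ ⟩
        degree G′ vt + sumFin n (λ x → δ (toℕ vt) (toℕ x))    ≡⟨ cong (degree G′ vt +_) (sumFin-δ vt) ⟩
        degree G′ vt + 1                                      ∎
        where open ≤-Reasoning
      degree-top : degree G′ vt + 1 ≡ d 0
      degree-top = trans (cong (_+ 1) (trans (realises′ vt) (cong d′ (toℕ-fromℕ< t<n))))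
                         (trans (+-comm (d′ t) 1) (trans (d′-lowered (inj₁ refl)) (top ≤-refl)))

    switch-candidate : adj G′ vt vm ≡ true →
                       ∃[ x ] x ≢ vt × x ≢ vm × adj G′ vt x ≡ false × d′ (toℕ vm) < d′ (toℕ x)
    switch-candidate tm∈ with top-misses-positive
    ... | x , x≢vt , 0<dₓ , tx∉ = x , x≢vt , x≢vm , tx∉ , d′ₘ<d′ₓ
      where
      x≢vm : x ≢ vm
      x≢vm refl = contradiction (trans (sym tm∈) tx∉) λ ()
      toℕ-≢ : ∀ {v} (v<n : v < n) → x ≢ fromℕ< v<n → toℕ x ≢ v
      toℕ-≢ v<n x≢ x≡ = x≢ (toℕ-injective (trans x≡ (sym (toℕ-fromℕ< v<n))))
      x≤m : toℕ x ≤ m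
      x≤m = ≮⇒≥ (λ m<x → <⇒≢ 0<dₓ (sym (beyond-m m<x)))
      d′ₘ<d′ₓ : d′ (toℕ vm) < d′ (toℕ x)
      d′ₘ<d′ₓ = subst₂ _≤_ (sym (trans (cong (λ j → 1 + d′ j) (toℕ-fromℕ< m<n)) (d′-lowered (inj₂ refl))))
                           (sym (d′-kept (toℕ-≢ t<n x≢vt) (toℕ-≢ m<n x≢vm)))
                           (antitone x≤m)

    realise-from-lowered : Graphic (d ∘ toℕ)
    realise-from-lowered =
      let G , realises = add-edge-or-switch {G = G′} {d = d′ ∘ toℕ} realises′ vt≢vm switch-candidate
      in  G , λ i → trans (realises i) (trans (cong (d′ (toℕ i) +_) (ends≡e i)) (d′+e (toℕ i)))
      where
      ends≡e : ∀ i → ends vt vm i ≡ e (toℕ i)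
      ends≡e i = cong₂ (λ a b → δ a (toℕ i) + δ b (toℕ i)) (toℕ-fromℕ< t<n) (toℕ-fromℕ< m<n)

edgeless : ∀ {n} → SimpleGraph n
edgeless = record { adj = λ _ _ → false ; symmetric = λ _ _ → refl ; loopless = λ _ → refl }

degree-edgeless : ∀ {n} (i : Fin n) → degree (edgeless {n}) i ≡ 0
degree-edgeless {n} i = trans (sumFin-toℕ n (λ _ → 0)) (∑-zero n (λ _ → refl))

realise : ∀ {n} s {d} → EGSequence n d → ∑ n d ≡ s → Graphic (d ∘ toℕ)
realise {n} s {d} egs ∑≡s with 0 <? d 0
... | no ¬0<d₀ =
  edgeless {n} , λ i → trans (degree-edgeless i) (sym (n≤0⇒n≡0 (≤-trans (antitone z≤n) (≮⇒≥ ¬0<d₀))))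
  where open EGSequence egs
... | yes 0<d₀ = via-lowered s (trans (LayOff.∑-d′ egs 0<d₀) ∑≡s)
  where
  open LayOff egs 0<d₀ using (d′; lowered-sequence)
  via-lowered : ∀ s → 2 + ∑ n d′ ≡ s → Graphic (d ∘ toℕ)
  via-lowered (suc (suc s)) 2+∑≡ =
    uncurry (Realisation.realise-from-lowered egs 0<d₀) (realise s lowered-sequence (suc-injective (suc-injective 2+∑≡)))

erdősGallai⇒graphic : ∀ {n d} → EGSequence n d → Graphic (d ∘ toℕ)
erdősGallai⇒graphic egs = realise _ egs refl

-- The φ*_JMS region

module _ where

  open import Data.Integer as ℤ using (+_; +≤+)
  open import Data.Integer.Properties using (pos-*; drop‿+≤+; ⊖-≥; m-n≡m⊖n)

  -- min(·, s) is concave, so on [0, Δ] it lies above its chord.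
  chord : ∀ {u s Δ} → u ≤ Δ → s ≤ Δ → s * u ≤ Δ * (u ⊓ s)
  chord {u} {s} {Δ} u≤Δ s≤Δ with ≤-total u s
  ... | inj₁ u≤s = subst (λ m → s * u ≤ Δ * m) (sym (m≤n⇒m⊓n≡m u≤s)) (*-monoˡ-≤ u s≤Δ)
  ... | inj₂ s≤u =
    subst (λ m → s * u ≤ Δ * m) (sym (m≥n⇒m⊓n≡n s≤u)) (subst (s * u ≤_) (*-comm s Δ) (*-monoʳ-≤ s u≤Δ))

  module BoundedEntries {n : ℕ} {a : ℕ → ℕ} {c₁ c₂ : ℕ}
                        (lower : ∀ {j} → j < n → c₂ ≤ a j) (upper : ∀ {j} → j < n → a j ≤ c₁) where

    head-upper : ∀ {k} → k ≤ n → ∑ k a ≤ k * c₁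
    head-upper {k} k≤n = ≤-trans (∑-mono k (λ j<k → upper (<-≤-trans j<k k≤n))) (≤-reflexive (∑-const k c₁))

    eg-above-c₁ : ∀ {k} → k ≤ n → c₁ < k → ∑ k a + k ≤ k * k + ∑[ k ≤ j < n ] (a j ⊓ k)
    eg-above-c₁ k≤n = eg-above-bound _ (head-upper k≤n)

    eg-below-c₂ : ∀ {k} → c₁ < n → k ≤ n → k ≤ c₂ → ∑ k a + k ≤ k * k + ∑[ k ≤ j < n ] (a j ⊓ k)
    eg-below-c₂ {k} c₁<n k≤n k≤c₂ = begin
      ∑ k a + k                         ≤⟨ +-monoˡ-≤ k (head-upper k≤n) ⟩
      k * c₁ + k                        ≡⟨ trans (+-comm (k * c₁) k) (sym (*-suc k c₁)) ⟩
      k * suc c₁                        ≤⟨ *-monoʳ-≤ k c₁<n ⟩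
      k * n                             ≡⟨ cong (k *_) (m+[n∸m]≡n k≤n) ⟨
      k * (k + (n ∸ k))                 ≡⟨ *-distribˡ-+ k k (n ∸ k) ⟩
      k * k + k * (n ∸ k)               ≡⟨ cong (λ t → k * k + t) (trans (*-comm k (n ∸ k)) (sym (∑-const (n ∸ k) k))) ⟩
      k * k + ∑[ k ≤ j < n ] k
        ≡⟨ cong (λ t → k * k + t) (∑-between-cong {k} {n} λ _ j<n → sym (m≥n⇒m⊓n≡n (≤-trans k≤c₂ (lower j<n)))) ⟩
      k * k + ∑[ k ≤ j < n ] (a j ⊓ k)  ∎
      where open ≤-Reasoning

  ∑-offset : ∀ m c (f : ℕ → ℕ) → ∑[ j < m ] (c + f j) ≡ m * c + ∑ m f
  ∑-offset m c f = trans (∑-+ m (λ _ → c) f) (cong (_+ ∑ m f) (∑-const m c))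

  module Excess {n : ℕ} {a : ℕ → ℕ} {c₂ Δ : ℕ}
                (lower : ∀ {j} → j < n → c₂ ≤ a j) (upper : ∀ {j} → j < n → a j ≤ c₂ + Δ)
                (s : ℕ) (k≤n : c₂ + s ≤ n) where

    k : ℕ
    k = c₂ + s

    u : ℕ → ℕ
    u j = a j ∸ c₂

    a≡c₂+u : ∀ {j} → j < n → a j ≡ c₂ + u j
    a≡c₂+u j<n = sym (m+[n∸m]≡n (lower j<n))

    u≤Δ : ∀ {j} → j < n → u j ≤ Δ
    u≤Δ j<n = subst (u _ ≤_) (m+n∸m≡n c₂ Δ) (∸-monoˡ-≤ c₂ (upper j<n))

    ℓ p τ : ℕ
    ℓ = ∑ k u
    p = ∑[ k ≤ j < n ] u j
    τ = ∑[ k ≤ j < n ] (u j ⊓ s)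

    head≡ : ∑ k a ≡ k * c₂ + ℓ
    head≡ = trans (∑-cong k (λ j<k → a≡c₂+u (<-≤-trans j<k k≤n))) (∑-offset k c₂ u)

    tail≡ : ∑[ k ≤ j < n ] (a j ⊓ k) ≡ (n ∸ k) * c₂ + τ
    tail≡ = trans (∑-between-cong {k} {n} (λ _ j<n → trans (cong (_⊓ k) (a≡c₂+u j<n)) (sym (+-distribˡ-⊓ c₂ _ s))))
                  (∑-offset (n ∸ k) c₂ (λ j → u (k + j) ⊓ s))

    total≡ : ∑ n a ≡ n * c₂ + (ℓ + p)
    total≡ = trans (∑-cong n a≡c₂+u) (trans (∑-offset n c₂ u) (cong (λ t → n * c₂ + t) (∑-split u k≤n)))

    ℓ≤kΔ : ℓ ≤ k * Δ
    ℓ≤kΔ = ≤-trans (∑-mono k (λ j<k → u≤Δ (<-≤-trans j<k k≤n))) (≤-reflexive (∑-const k Δ))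

    ℓ+p≤nΔ : ℓ + p ≤ n * Δ
    ℓ+p≤nΔ = subst (_≤ n * Δ) (∑-split u k≤n) (≤-trans (∑-mono n u≤Δ) (≤-reflexive (∑-const n Δ)))

    sp≤Δτ : s ≤ Δ → s * p ≤ Δ * τ
    sp≤Δτ s≤Δ = begin
      s * p                              ≡⟨ ∑-*ˡ (n ∸ k) s _ ⟨
      ∑[ k ≤ j < n ] (s * u j)            ≤⟨ ∑-between-mono {k} {n} (λ _ j<n → chord (u≤Δ j<n) s≤Δ) ⟩
      ∑[ k ≤ j < n ] (Δ * (u j ⊓ s))      ≡⟨ ∑-*ˡ (n ∸ k) Δ _ ⟩
      Δ * τ                              ∎
      where open ≤-Reasoning

  +-∸ : ∀ {m n} → m ≤ n → + (n ∸ m) ≡ + n ℤ.- + m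
  +-∸ {m} {n} m≤n = sym (trans (m-n≡m⊖n n m) (⊖-≥ m≤n))

  eg-between-c₂-c₁ : ∀ {n a S c₁ c₂ k} → c₁ < n → c₂ ≤ c₁ → φJMS n S c₁ c₂ →
                     (∀ {j} → j < n → c₂ ≤ a j) → (∀ {j} → j < n → a j ≤ c₁) → ∑ n a ≡ S →
                     c₂ < k → k ≤ c₁ → ∑ k a + k ≤ k * k + ∑[ k ≤ j < n ] (a j ⊓ k)
  eg-between-c₂-c₁ {n} {a} {S} {c₁} {c₂} {k} c₁<n c₂≤c₁ φ lower upper ∑≡S c₂<k k≤c₁
    with m≤n⇒∃[o]m+o≡n c₂≤c₁ | m≤n⇒∃[o]m+o≡n (<⇒≤ c₂<k) | m≤n⇒∃[o]m+o≡n (subst (_≤ n) (+-comm 1 c₁) c₁<n)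
  ... | Δ , refl | s , refl | r , refl = begin
    ∑ k a + k                           ≡⟨ cong (_+ k) head≡ ⟩
    k * c₂ + ℓ + k                      ≤⟨ drop‿+≤+ (subst₂ ℤ._≤_ (sym lhs≡) (sym rhs≡) bound) ⟩
    k * k + ((n ∸ k) * c₂ + τ)          ≡⟨ cong (λ t → k * k + t) tail≡ ⟨
    k * k + ∑[ k ≤ j < n ] (a j ⊓ k)    ∎
    where
    open ≤-Reasoning
    k≤n : k ≤ n
    k≤n = ≤-trans k≤c₁ (≤-trans (m≤m+n (c₂ + Δ) 1) (m≤m+n _ r))
    open Excess lower upper s k≤n using (ℓ; p; τ; head≡; tail≡; total≡; ℓ≤kΔ; ℓ+p≤nΔ; sp≤Δτ)
    s≤Δ : s ≤ Δ
    s≤Δ = +-cancelˡ-≤ c₂ s Δ k≤c₁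
    1≤s : 1 ≤ s
    1≤s = +-cancelˡ-< c₂ 0 s (subst (_< c₂ + s) (sym (+-identityʳ c₂)) c₂<k)
    jms : JMS (+ n) (+ n ℤ.* + c₂ ℤ.+ (+ ℓ ℤ.+ + p)) (+ c₂ ℤ.+ + Δ) (+ c₂)
    jms = subst (λ S′ → JMS (+ n) S′ (+ (c₂ + Δ)) (+ c₂))
                (trans (cong +_ (trans (sym ∑≡S) total≡)) (cong (ℤ._+ + (ℓ + p)) (pos-* n c₂))) φ
    bound : + k ℤ.* + c₂ ℤ.+ + ℓ ℤ.+ + k ℤ.≤ + k ℤ.* + k ℤ.+ ((+ n ℤ.- + k) ℤ.* + c₂ ℤ.+ + τ)
    bound = JMSBound.jms-eg-bound (+ c₂) (+ Δ) (+ s) (+ r) (+ ℓ) (+ p) (+ τ)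
              (+≤+ z≤n) (+≤+ z≤n) (+≤+ 1≤s) (+≤+ s≤Δ) (+≤+ z≤n)
              (subst (+ ℓ ℤ.≤_) (pos-* k Δ) (+≤+ ℓ≤kΔ)) (subst (+ (ℓ + p) ℤ.≤_) (pos-* n Δ) (+≤+ ℓ+p≤nΔ))
              (subst₂ ℤ._≤_ (pos-* s p) (pos-* Δ τ) (+≤+ (sp≤Δτ s≤Δ))) jms
    lhs≡ : + (k * c₂ + ℓ + k) ≡ + k ℤ.* + c₂ ℤ.+ + ℓ ℤ.+ + k
    lhs≡ = cong (λ z → z ℤ.+ + ℓ ℤ.+ + k) (pos-* k c₂)
    rhs≡ : + (k * k + ((n ∸ k) * c₂ + τ)) ≡ + k ℤ.* + k ℤ.+ ((+ n ℤ.- + k) ℤ.* + c₂ ℤ.+ + τ)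
    rhs≡ = cong₂ (λ z w → z ℤ.+ (w ℤ.+ + τ)) (pos-* k k) (trans (pos-* (n ∸ k) c₂) (cong (ℤ._* + c₂) (+-∸ k≤n)))

  jms⇒erdősGallai : ∀ {n a S c₁ c₂} → c₁ < n → c₂ ≤ c₁ → φJMS n S c₁ c₂ →
                    (∀ {j} → j < n → c₂ ≤ a j) → (∀ {j} → j < n → a j ≤ c₁) → ∑ n a ≡ S → ErdősGallai n a
  jms⇒erdősGallai {c₁ = c₁} {c₂} c₁<n c₂≤c₁ φ lower upper ∑≡S {k} k≤n with c₁ <? k | k ≤? c₂
  ... | yes c₁<k | _        = BoundedEntries.eg-above-c₁ lower upper k≤n c₁<k
  ... | no  c₁≮k | yes k≤c₂ = BoundedEntries.eg-below-c₂ lower upper c₁<n k≤n k≤c₂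
  ... | no  c₁≮k | no  k≰c₂ = eg-between-c₂-c₁ c₁<n c₂≤c₁ φ lower upper ∑≡S (≰⇒> k≰c₂) (≮⇒≥ c₁≮k)

theorem3p6 : (n : ℕ) (d : Fin n → ℕ) → InRegion d → Graphic d
theorem3p6 n d (S , c₁ , c₂ , c₁<n , c₂≤c₁ , φ , upper , lower , sorted , even , ∑≡S) =
  let G , realises = erdősGallai⇒graphic egs in G , λ i → trans (realises i) (extend-toℕ d i)
  where
  egs : EGSequence n (extend d)
  egs = record
    { vanishing = extend-≥ d
    ; antitone  = extend-antitone sorted
    ; even      = subst (2 ∣_) (sumFin-extend d) even
    ; eg        = jms⇒erdősGallai c₁<n c₂≤c₁ φ (extend-all {P = c₂ ≤_} lower) (extend-all {P = _≤ c₁} upper)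
                                  (trans (sym (sumFin-extend d)) ∑≡S)
    }
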